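{- Let $n,a_1,a_2$ satisfy the standing assumptions below, and let $H=(v_0,v_1,\dots,v_{n-1},v_n=v_0)$ be a Hamiltonian cycle in the circulant graph $C\langle\{a_1,a_2\}\rangle$. Let $H'=(u_0,\dots,u_{n-1},u_n=u_0)$ where $u_i=v_i+a_2\bmod n$. Then $H'$ is a Hamiltonian cycle, and for any two columns $C_s$ and $C_{s+1\bmod g_1}$, the number of edges of length $a_2$ between $C_s$ and $C_{s+1\bmod g_1}$ in $H$ equals the number of edges of length $a_2$ between $C_{s+1\bmod g_1}$ and $C_{s+2\bmod g_1}$ in $H'$.
   Context: $C\langle\{a_1,a_2\}\rangle$ is the graph on $\mathbb{Z}_n$ whose edges are $\{v,v\pm a_1 \bmod n\}$ and $\{v,v\pm a_2\bmod n\}$, where $a_1,a_2$ are distinct elements of $\{1,\dots,\lfloor n/2\rfloor\}$. Standing assumptions: $g_1=\gcd(n,a_1)>1$, $\gcd(n,a_1,a_2)=1$. With $r=n/g_1$, every vertex can be written uniquely as $x a_1 + y a_2 \bmod n$ with $0\le x\le r-1$, $0\le y\le g_1-1$; it lies in column $C_y$ (the columns are the connected components of the graph with only the $a_1$-edges). -}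

module Defs where

open import Data.Nat using (ℕ; zero; suc; _+_; _*_; _<_; _≤_; _<?_)
open import Data.Nat.Properties using (_≟_)
open import Data.Nat.DivMod using (_%_)
open import Data.Nat.GCD using (gcd; gcd[m,n]∣m)
open import Data.Nat.Divisibility using (_∣_)
open import Data.Fin using (Fin; toℕ)
open import Data.Fin.Properties using (any?)
open import Data.Product using (_×_; ∃)
open import Data.Sum using (_⊎_)
open import Data.List using (List; length; filter)
open import Data.List using (upTo)
open import Relation.Binary.PropositionalEquality using (_≡_)
open import Relation.Nullary using (Dec; ¬_)
open import Relation.Nullary.Decidable using (_×-dec_; _⊎-dec_)

-- m mod k, for k ≥ 1 (the value for k = 0 is irrelevant: it is never used
-- under the standing assumptions, where n ≥ 2 and g₁ ≥ 2).
_mod_ : ℕ → ℕ → ℕ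
m mod zero = m
m mod suc k = m % suc k

g₁ : ℕ → ℕ → ℕ
g₁ n a₁ = gcd n a₁

r : ℕ → ℕ → ℕ
r n a₁ = _∣_.quotient (gcd[m,n]∣m n a₁)

record Standing (n a₁ a₂ : ℕ) : Set where
  field
    a₁-pos  : 1 ≤ a₁
    a₁-le   : a₁ * 2 ≤ n
    a₂-pos  : 1 ≤ a₂
    a₂-le   : a₂ * 2 ≤ n
    distinct : ¬ (a₁ ≡ a₂)
    g₁>1    : 1 < gcd n a₁
    coprime : gcd n (gcd a₁ a₂) ≡ 1

EdgeLen : (n a u w : ℕ) → Set
EdgeLen n a u w = (w ≡ (u + a) mod n) ⊎ (u ≡ (w + a) mod n)

edgeLen? : (n a u w : ℕ) → Dec (EdgeLen n a u w)
edgeLen? n a u w = (w ≟ (u + a) mod n) ⊎-dec (u ≟ (w + a) mod n)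

Adj : (n a₁ a₂ u w : ℕ) → Set
Adj n a₁ a₂ u w = EdgeLen n a₁ u w ⊎ EdgeLen n a₂ u w

-- a Hamiltonian cycle (v₀, …, v_{n-1}, v_n = v₀), given as v : ℕ → ℕ
-- (only the values at 0 … n-1 matter): all vᵢ are vertices, pairwise
-- distinct (hence all n vertices occur), and vᵢ ~ v_{i+1 mod n}.
IsHamCycle : (n a₁ a₂ : ℕ) → (ℕ → ℕ) → Set
IsHamCycle n a₁ a₂ v =
  (∀ i → i < n → v i < n) ×
  (∀ i j → i < n → j < n → v i ≡ v j → i ≡ j) ×
  (∀ i → i < n → Adj n a₁ a₂ (v i) (v ((suc i) mod n)))

InColumn : (n a₁ a₂ u y : ℕ) → Set
InColumn n a₁ a₂ u y =
  y < g₁ n a₁ × ∃ λ (x : Fin (r n a₁)) → (toℕ x * a₁ + y * a₂) mod n ≡ u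

inColumn? : (n a₁ a₂ u y : ℕ) → Dec (InColumn n a₁ a₂ u y)
inColumn? n a₁ a₂ u y =
  (y <? g₁ n a₁) ×-dec any? (λ x → (toℕ x * a₁ + y * a₂) mod n ≟ u)

A₂EdgeBetween : (n a₁ a₂ s t u w : ℕ) → Set
A₂EdgeBetween n a₁ a₂ s t u w =
  EdgeLen n a₂ u w ×
  ((InColumn n a₁ a₂ u s × InColumn n a₁ a₂ w t) ⊎
   (InColumn n a₁ a₂ u t × InColumn n a₁ a₂ w s))

a₂EdgeBetween? : (n a₁ a₂ s t u w : ℕ) → Dec (A₂EdgeBetween n a₁ a₂ s t u w)
a₂EdgeBetween? n a₁ a₂ s t u w =
  edgeLen? n a₂ u w ×-dec
  ((inColumn? n a₁ a₂ u s ×-dec inColumn? n a₁ a₂ w t) ⊎-dec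
   (inColumn? n a₁ a₂ u t ×-dec inColumn? n a₁ a₂ w s))

countA₂ : (n a₁ a₂ : ℕ) → (ℕ → ℕ) → (s t : ℕ) → ℕ
countA₂ n a₁ a₂ v s t =
  length (filter (λ i → a₂EdgeBetween? n a₁ a₂ s t (v i) (v ((suc i) mod n)))
                 (upTo n))

-- Translation u ↦ u + a₂ (mod n) is an automorphism of C⟨{a₁,a₂}⟩, so it maps H to a
-- Hamiltonian cycle H' and the i-th edge of H to the i-th edge of H', preserving lengths.
-- It maps C_y onto C_{y+1 mod g₁}: from u = x a₁ + y a₂ we get u + a₂ = x a₁ + (y+1) a₂,
-- and at the wrap-around y + 1 = g₁ the term g₁ a₂ is absorbed into the a₁-part, because
-- g₁ = gcd(n, a₁) is a multiple of a₁ modulo n (Bézout).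

module Submission where

open import Defs
open import Level using (0ℓ)
open import Data.Nat using (ℕ; suc; pred; _+_; _*_; _<_; _≤_; NonZero; z<s; >-nonZero)
open import Data.Nat.Properties using (<-trans; ≤-trans; m≤m*n; m≤n⇒m<n∨m≡n; m*n≢0⇒m≢0; suc-pred;
         +-identityʳ; +-assoc; +-comm; *-suc; *-assoc; *-zeroʳ; *-distribʳ-+;
         +-commutativeSemigroup; *-commutativeSemigroup)
open import Data.Nat.DivMod
  using (_%_; _/_; m%n%n≡m%n; m%n<n; m<n⇒m%n≡m; n%n≡0; [m+kn]%n≡m%n; %-distribˡ-+; %-distribˡ-*; m≡m%n+[m/n]*n)
open import Data.Nat.GCD using (gcd-GCD; gcd[m,n]∣m; gcd[m,n]∣n; module Bézout)
open import Data.Nat.Divisibility using (_∣_)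
open import Data.Fin using (toℕ; fromℕ<)
open import Data.Fin.Properties using (toℕ-fromℕ<)
import Algebra.Properties.CommutativeSemigroup as CommutativeSemigroupProperties
open import Data.Product using (_,_; _×_; ∃; proj₁; proj₂)
open import Data.Product.Function.NonDependent.Propositional using (_×-⇔_)
open import Data.Sum using (inj₁; inj₂)
open import Data.Sum.Function.Propositional using (_⊎-⇔_)
open import Data.List using (List; []; _∷_; length; filter)
open import Data.List.Relation.Unary.All as All using (All; []; _∷_)
open import Data.List.Relation.Unary.All.Properties using (all-upTo)
open import Function using (_∘_; const; it)
open import Function.Bundles using (_⇔_; mk⇔; Equivalence)
open import Function.Construct.Composition using (_⇔-∘_)
open import Function.Construct.Identity using (⇔-id)
open import Function.Construct.Symmetry using (⇔-sym)
open import Relation.Binary.Bundles using (Setoid)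
import Relation.Binary.Reasoning.Setoid as SetoidReasoning
open import Relation.Binary.PropositionalEquality as ≡ using (_≡_; refl; cong; cong₂; subst)
open import Relation.Nullary using (yes; no; contradiction)
open import Relation.Unary using (Pred; Decidable)

open Equivalence using (to; from)

module +-CS = CommutativeSemigroupProperties +-commutativeSemigroup
module *-CS = CommutativeSemigroupProperties *-commutativeSemigroup

mod≡% : ∀ x k .{{_ : NonZero k}} → x mod k ≡ x % k
mod≡% x (suc k) = refl

length-filter-⇔ : ∀ {a p q} {A : Set a} {P : Pred A p} {Q : Pred A q}
  (P? : Decidable P) (Q? : Decidable Q) {xs : List A} →
  All (λ x → P x ⇔ Q x) xs → length (filter P? xs) ≡ length (filter Q? xs)
length-filter-⇔ P? Q? [] = refl
length-filter-⇔ P? Q? {x ∷ _} (P⇔Q ∷ rest) with P? x | Q? x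
... | yes _  | yes _  = cong suc (length-filter-⇔ P? Q? rest)
... | no  _  | no  _  = length-filter-⇔ P? Q? rest
... | yes px | no ¬qx = contradiction (to P⇔Q px) ¬qx
... | no ¬px | yes qx = contradiction (from P⇔Q qx) ¬px

module Congruence (n : ℕ) .{{_ : NonZero n}} where

  infix 4 _≈_
  record _≈_ (x y : ℕ) : Set where
    constructor mk≈
    field %≡% : x % n ≡ y % n
  open _≈_

  setoid : Setoid 0ℓ 0ℓ
  setoid = record
    { _≈_ = _≈_
    ; isEquivalence = record
      { refl  = mk≈ refl
      ; sym   = λ x≈y → mk≈ (≡.sym (%≡% x≈y))
      ; trans = λ x≈y y≈z → mk≈ (≡.trans (%≡% x≈y) (%≡% y≈z))
      }
    }

  open Setoid setoid public using ()
    renaming (refl to ≈-refl; reflexive to ≈-reflexive; sym to ≈-sym; trans to ≈-trans)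
  open SetoidReasoning setoid public

  mod-< : ∀ x → x mod n < n
  mod-< x = subst (_< n) (≡.sym (mod≡% x n)) (m%n<n x n)

  mod-≈ : ∀ x → x mod n ≈ x
  mod-≈ x = mk≈ (≡.trans (cong (_% n) (mod≡% x n)) (m%n%n≡m%n x n))

  mod≡⇒≈ : ∀ {x y} → x mod n ≡ y → x ≈ y
  mod≡⇒≈ {x} refl = ≈-sym (mod-≈ x)

  ≈⇒mod≡ : ∀ {x y} → y < n → x ≈ y → x mod n ≡ y
  ≈⇒mod≡ {x} y<n (mk≈ x≡y) = ≡.trans (mod≡% x n) (≡.trans x≡y (m<n⇒m%n≡m y<n))

  ≈⇒≡ : ∀ {x y} → x < n → y < n → x ≈ y → x ≡ y
  ≈⇒≡ x<n y<n (mk≈ x≡y) = ≡.trans (≡.sym (m<n⇒m%n≡m x<n)) (≡.trans x≡y (m<n⇒m%n≡m y<n))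

  +-cong : ∀ {a b c d} → a ≈ b → c ≈ d → a + c ≈ b + d
  +-cong {a} {b} {c} {d} (mk≈ a≡b) (mk≈ c≡d) = mk≈ (≡.trans (%-distribˡ-+ a c n)
    (≡.trans (cong₂ (λ x y → (x + y) % n) a≡b c≡d) (≡.sym (%-distribˡ-+ b d n))))

  *-cong : ∀ {a b c d} → a ≈ b → c ≈ d → a * c ≈ b * d
  *-cong {a} {b} {c} {d} (mk≈ a≡b) (mk≈ c≡d) = mk≈ (≡.trans (%-distribˡ-* a c n)
    (≡.trans (cong₂ (λ x y → (x * y) % n) a≡b c≡d) (≡.sym (%-distribˡ-* b d n))))

  +-congˡ : ∀ a {c d} → c ≈ d → a + c ≈ a + d
  +-congˡ a = +-cong (≈-refl {a})

  +-congʳ : ∀ c {a b} → a ≈ b → a + c ≈ b + c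
  +-congʳ c a≈b = +-cong a≈b (≈-refl {c})

  *-congˡ : ∀ a {c d} → c ≈ d → a * c ≈ a * d
  *-congˡ a = *-cong (≈-refl {a})

  *-congʳ : ∀ c {a b} → a ≈ b → a * c ≈ b * c
  *-congʳ c a≈b = *-cong a≈b (≈-refl {c})

  +*n≈ : ∀ x k → x + k * n ≈ x
  +*n≈ x k = mk≈ ([m+kn]%n≡m%n x k n)

  *n≈0 : ∀ k → k * n ≈ 0
  *n≈0 = +*n≈ 0

  -- b * pred n plays the role of −b.
  +-inverseʳ : ∀ b → b + b * pred n ≈ 0
  +-inverseʳ b = begin
    b + b * pred n    ≡⟨ ≡.sym (*-suc b (pred n)) ⟩
    b * suc (pred n)  ≡⟨ cong (b *_) (suc-pred n) ⟩
    b * n             ≈⟨ *n≈0 b ⟩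
    0                 ∎

  +-cancelʳ : ∀ {a b} c → a + c ≈ b + c → a ≈ b
  +-cancelʳ {a} {b} c a+c≈b+c = begin
    a                           ≡⟨ ≡.sym (+-identityʳ a) ⟩
    a + 0                       ≈⟨ +-congˡ a (≈-sym (+-inverseʳ c)) ⟩
    a + (c + c * pred n)        ≡⟨ ≡.sym (+-assoc a c _) ⟩
    (a + c) + c * pred n        ≈⟨ +-congʳ (c * pred n) a+c≈b+c ⟩
    (b + c) + c * pred n        ≡⟨ +-assoc b c _ ⟩
    b + (c + c * pred n)        ≈⟨ +-congˡ b (+-inverseʳ c) ⟩
    b + 0                       ≡⟨ +-identityʳ b ⟩
    b                           ∎

  +≈0⇒≈*pred : ∀ {a} b → a + b ≈ 0 → a ≈ b * pred n
  +≈0⇒≈*pred {a} b a+b≈0 = +-cancelʳ b (begin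
    a + b                ≈⟨ a+b≈0 ⟩
    0                    ≈⟨ ≈-sym (+-inverseʳ b) ⟩
    b + b * pred n       ≡⟨ +-comm b _ ⟩
    b * pred n + b       ∎)

  suc-mod-mod : ∀ x → suc (x mod n) mod n ≡ suc x mod n
  suc-mod-mod x = ≈⇒mod≡ (mod-< (suc x)) (begin
    suc (x mod n)  ≈⟨ +-congˡ 1 (mod-≈ x) ⟩
    suc x          ≈⟨ ≈-sym (mod-≈ (suc x)) ⟩
    suc x mod n    ∎)

module Translation (n : ℕ) .{{_ : NonZero n}} (d : ℕ) where
  open Congruence n

  τ : ℕ → ℕ
  τ u = (u + d) mod n

  τ-injective : ∀ {u w} → u < n → w < n → τ u ≡ τ w → u ≡ w
  τ-injective {u} {w} u<n w<n τu≡τw = ≈⇒≡ u<n w<n (+-cancelʳ d (begin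
    u + d  ≈⟨ ≈-sym (mod-≈ (u + d)) ⟩
    τ u    ≡⟨ τu≡τw ⟩
    τ w    ≈⟨ mod-≈ (w + d) ⟩
    w + d  ∎))

  τ-+ : ∀ u c → τ u + c ≈ (u + c) + d
  τ-+ u c = begin
    τ u + c      ≈⟨ +-congʳ c (mod-≈ (u + d)) ⟩
    (u + d) + c  ≡⟨ +-assoc u d c ⟩
    u + (d + c)  ≡⟨ cong (u +_) (+-comm d c) ⟩
    u + (c + d)  ≡⟨ ≡.sym (+-assoc u c d) ⟩
    (u + c) + d  ∎

  τ-step : ∀ {c u w} → w < n → (w ≡ (u + c) mod n) ⇔ (τ w ≡ (τ u + c) mod n)
  τ-step {c} {u} {w} w<n = mk⇔
    (λ w≡ → ≡.sym (≈⇒mod≡ (mod-< (w + d)) (begin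
      τ u + c      ≈⟨ τ-+ u c ⟩
      (u + c) + d  ≈⟨ +-congʳ d (mod≡⇒≈ (≡.sym w≡)) ⟩
      w + d        ≈⟨ ≈-sym (mod-≈ (w + d)) ⟩
      τ w          ∎)))
    (λ τw≡ → ≡.sym (≈⇒mod≡ w<n (+-cancelʳ d (begin
      (u + c) + d  ≈⟨ ≈-sym (τ-+ u c) ⟩
      τ u + c      ≈⟨ mod≡⇒≈ (≡.sym τw≡) ⟩
      τ w          ≈⟨ mod-≈ (w + d) ⟩
      w + d        ∎))))

  edgeLen-τ : ∀ {c u w} → u < n → w < n → EdgeLen n c u w ⇔ EdgeLen n c (τ u) (τ w)
  edgeLen-τ u<n w<n = τ-step w<n ⊎-⇔ τ-step u<n

  adj-τ : ∀ {a₁ a₂ u w} → u < n → w < n → Adj n a₁ a₂ u w ⇔ Adj n a₁ a₂ (τ u) (τ w)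
  adj-τ u<n w<n = edgeLen-τ u<n w<n ⊎-⇔ edgeLen-τ u<n w<n

  isHamCycle-τ : ∀ {a₁ a₂ v} → IsHamCycle n a₁ a₂ v → IsHamCycle n a₁ a₂ (τ ∘ v)
  isHamCycle-τ {v = v} (v<n , v-injective , v-adj) =
    (λ i _ → mod-< (v i + d)) ,
    (λ i j i<n j<n τvi≡τvj → v-injective i j i<n j<n (τ-injective (v<n i i<n) (v<n j j<n) τvi≡τvj)) ,
    (λ i i<n → to (adj-τ (v<n i i<n) (v<n _ (mod-< (suc i)))) (v-adj i i<n))

module Columns (n a₁ a₂ : ℕ) .{{_ : NonZero n}} (1<g : 1 < g₁ n a₁) where
  open Congruence n
  open Translation n a₂

  g : ℕ
  g = g₁ n a₁

  private
    g∣n : g ∣ n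
    g∣n = gcd[m,n]∣m n a₁

    g∣a₁ : g ∣ a₁
    g∣a₁ = gcd[m,n]∣n n a₁

  instance
    g-nonZero : NonZero g
    g-nonZero = >-nonZero (<-trans z<s 1<g)

    r-nonZero : NonZero (r n a₁)
    r-nonZero = m*n≢0⇒m≢0 (r n a₁) {{subst NonZero (_∣_.equality g∣n) it}}

  r*a₁≈0 : r n a₁ * a₁ ≈ 0
  r*a₁≈0 = begin
    r n a₁ * a₁        ≡⟨ cong (r n a₁ *_) (_∣_.equality g∣a₁) ⟩
    r n a₁ * (e * g)   ≡⟨ *-CS.x∙yz≈y∙xz (r n a₁) e g ⟩
    e * (r n a₁ * g)   ≡⟨ cong (e *_) (≡.sym (_∣_.equality g∣n)) ⟩
    e * n              ≈⟨ *n≈0 e ⟩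
    0                  ∎
    where e : ℕ
          e = _∣_.quotient g∣a₁

  %r*a₁≈*a₁ : ∀ x → x % r n a₁ * a₁ ≈ x * a₁
  %r*a₁≈*a₁ x = ≈-sym (begin
    x * a₁                                ≡⟨ cong (_* a₁) (m≡m%n+[m/n]*n x r′) ⟩
    (x % r′ + x / r′ * r′) * a₁           ≡⟨ *-distribʳ-+ a₁ (x % r′) _ ⟩
    x % r′ * a₁ + x / r′ * r′ * a₁        ≡⟨ cong (x % r′ * a₁ +_) (*-assoc (x / r′) r′ a₁) ⟩
    x % r′ * a₁ + x / r′ * (r′ * a₁)      ≈⟨ +-congˡ (x % r′ * a₁) (*-congˡ (x / r′) r*a₁≈0) ⟩
    x % r′ * a₁ + x / r′ * 0              ≡⟨ cong (x % r′ * a₁ +_) (*-zeroʳ (x / r′)) ⟩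
    x % r′ * a₁ + 0                       ≡⟨ +-identityʳ _ ⟩
    x % r′ * a₁                           ∎)
    where r′ : ℕ
          r′ = r n a₁

  g≈*a₁ : ∃ λ p → p * a₁ ≈ g
  g≈*a₁ with Bézout.identity (gcd-GCD n a₁)
  ... | Bézout.-+ x y g+xn≡ya₁ = y , ≈-sym (begin
    g                ≈⟨ ≈-sym (+*n≈ g x) ⟩
    g + x * n        ≡⟨ g+xn≡ya₁ ⟩
    y * a₁           ∎)
  ... | Bézout.+- x y g+ya₁≡xn = y * pred n , ≈-sym (begin
    g                 ≈⟨ +≈0⇒≈*pred (y * a₁) (≈-trans (≈-reflexive g+ya₁≡xn) (*n≈0 x)) ⟩
    y * a₁ * pred n   ≡⟨ *-CS.xy∙z≈xz∙y y a₁ (pred n) ⟩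
    y * pred n * a₁   ∎)

  private
    p : ℕ
    p = proj₁ g≈*a₁

  p*z*a₁≈g*z : ∀ z → p * z * a₁ ≈ g * z
  p*z*a₁≈g*z z = begin
    p * z * a₁  ≡⟨ *-CS.xy∙z≈xz∙y p z a₁ ⟩
    p * a₁ * z  ≈⟨ *-congʳ z (proj₂ g≈*a₁) ⟩
    g * z       ∎

  p*[z*pred]*a₁+g*z≈0 : ∀ z → p * (z * pred n) * a₁ + g * z ≈ 0
  p*[z*pred]*a₁+g*z≈0 z = begin
    p * (z * pred n) * a₁ + g * z  ≈⟨ +-congʳ (g * z) (p*z*a₁≈g*z (z * pred n)) ⟩
    g * (z * pred n) + g * z       ≡⟨ +-comm _ (g * z) ⟩
    g * z + g * (z * pred n)       ≡⟨ cong (g * z +_) (≡.sym (*-assoc g z (pred n))) ⟩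
    g * z + g * z * pred n         ≈⟨ +-inverseʳ (g * z) ⟩
    0                              ∎

  -- C_y with x ranging over all of ℕ; x and x mod r name the same vertex (%r*a₁≈*a₁).
  Column : ℕ → ℕ → Set
  Column u y = ∃ λ x → x * a₁ + y * a₂ ≈ u

  column-resp : ∀ {u w y} → u ≈ w → Column u y ⇔ Column w y
  column-resp u≈w = mk⇔ (λ (x , e) → x , ≈-trans e u≈w) (λ (x , e) → x , ≈-trans e (≈-sym u≈w))

  column-periodic : ∀ {u} y → Column u (y + g) ⇔ Column u y
  column-periodic {u} y = mk⇔ dropPeriod addPeriod
    where
    dropPeriod : Column u (y + g) → Column u y
    dropPeriod (x , e) = x + q , (begin
      (x + q) * a₁ + y * a₂       ≡⟨ cong (_+ y * a₂) (*-distribʳ-+ a₁ x q) ⟩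
      x * a₁ + q * a₁ + y * a₂    ≡⟨ +-CS.xy∙z≈xz∙y (x * a₁) (q * a₁) (y * a₂) ⟩
      x * a₁ + y * a₂ + q * a₁    ≈⟨ +-congˡ (x * a₁ + y * a₂) (p*z*a₁≈g*z a₂) ⟩
      x * a₁ + y * a₂ + g * a₂    ≡⟨ +-assoc (x * a₁) (y * a₂) (g * a₂) ⟩
      x * a₁ + (y * a₂ + g * a₂)  ≡⟨ cong (x * a₁ +_) (≡.sym (*-distribʳ-+ a₂ y g)) ⟩
      x * a₁ + (y + g) * a₂       ≈⟨ e ⟩
      u                           ∎)
      where q : ℕ
            q = p * a₂

    addPeriod : Column u y → Column u (y + g)
    addPeriod (x , e) = x + q , (begin
      (x + q) * a₁ + (y + g) * a₂            ≡⟨ cong₂ _+_ (*-distribʳ-+ a₁ x q) (*-distribʳ-+ a₂ y g) ⟩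
      (x * a₁ + q * a₁) + (y * a₂ + g * a₂)  ≡⟨ +-CS.interchange (x * a₁) (q * a₁) (y * a₂) (g * a₂) ⟩
      (x * a₁ + y * a₂) + (q * a₁ + g * a₂)  ≈⟨ +-congˡ (x * a₁ + y * a₂) (p*[z*pred]*a₁+g*z≈0 a₂) ⟩
      (x * a₁ + y * a₂) + 0                  ≡⟨ +-identityʳ _ ⟩
      x * a₁ + y * a₂                        ≈⟨ e ⟩
      u                                      ∎)
      where q : ℕ
            q = p * (a₂ * pred n)

  column-suc : ∀ {u y} → Column u y ⇔ Column (u + a₂) (suc y)
  column-suc {u} {y} = mk⇔
    (λ (x , e) → x , ≈-trans (≈-reflexive (regroup x)) (+-congʳ a₂ e))
    (λ (x , e) → x , +-cancelʳ a₂ (≈-trans (≈-reflexive (≡.sym (regroup x))) e))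
    where
    regroup : ∀ x → x * a₁ + suc y * a₂ ≡ x * a₁ + y * a₂ + a₂
    regroup x = +-CS.x∙yz≈xz∙y (x * a₁) a₂ (y * a₂)

  column-mod : ∀ {u y} → y ≤ g → Column u y ⇔ Column u (y mod g)
  column-mod {u} {y} y≤g with m≤n⇒m<n∨m≡n y≤g
  ... | inj₁ y<g = subst (λ z → Column u y ⇔ Column u z) (≡.sym (≡.trans (mod≡% y g) (m<n⇒m%n≡m y<g))) (⇔-id _)
  ... | inj₂ refl = subst (λ z → Column u g ⇔ Column u z) (≡.sym (≡.trans (mod≡% g g) (n%n≡0 g))) (column-periodic 0)

  column-next : ∀ {u y} → y < g → Column u y ⇔ Column (τ u) (suc y mod g)
  column-next {u} {y} y<g =
    column-mod {τ u} {suc y} y<g ⇔-∘ (column-resp {y = suc y} (≈-sym (mod-≈ (u + a₂))) ⇔-∘ column-suc {u} {y})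

  inColumn⇔column : ∀ {u y} → u < n → InColumn n a₁ a₂ u y ⇔ (y < g × Column u y)
  inColumn⇔column {u} {y} u<n = mk⇔
    (λ (y<g , x , e) → y<g , toℕ x , mod≡⇒≈ e)
    (λ (y<g , x , e) → y<g , fromℕ< (m%n<n x (r n a₁)) , ≈⇒mod≡ u<n (begin
      toℕ (fromℕ< (m%n<n x (r n a₁))) * a₁ + y * a₂  ≡⟨ cong (λ t → t * a₁ + y * a₂) (toℕ-fromℕ< (m%n<n x (r n a₁))) ⟩
      x % r n a₁ * a₁ + y * a₂                        ≈⟨ +-congʳ (y * a₂) (%r*a₁≈*a₁ x) ⟩
      x * a₁ + y * a₂                                 ≈⟨ e ⟩
      u                                               ∎))

  inColumn-τ : ∀ {u y} → u < n → y < g → InColumn n a₁ a₂ u y ⇔ InColumn n a₁ a₂ (τ u) (suc y mod g)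
  inColumn-τ {u} {y} u<n y<g =
    ⇔-sym (inColumn⇔column (mod-< (u + a₂))) ⇔-∘
    ((mk⇔ (const (G.mod-< (suc y))) (const y<g) ×-⇔ column-next y<g) ⇔-∘ inColumn⇔column u<n)
    where module G = Congruence g

  a₂EdgeBetween-τ : ∀ {s t u w} → s < g → t < g → u < n → w < n →
    A₂EdgeBetween n a₁ a₂ s t u w ⇔ A₂EdgeBetween n a₁ a₂ (suc s mod g) (suc t mod g) (τ u) (τ w)
  a₂EdgeBetween-τ s<g t<g u<n w<n = edgeLen-τ u<n w<n ×-⇔
    ((inColumn-τ u<n s<g ×-⇔ inColumn-τ w<n t<g) ⊎-⇔ (inColumn-τ u<n t<g ×-⇔ inColumn-τ w<n s<g))

  countA₂-τ : ∀ {v s t} → (∀ i → i < n → v i < n) → s < g → t < g →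
    countA₂ n a₁ a₂ v s t ≡ countA₂ n a₁ a₂ (τ ∘ v) (suc s mod g) (suc t mod g)
  countA₂-τ v<n s<g t<g = length-filter-⇔ _ _
    (All.map (λ {i} i<n → a₂EdgeBetween-τ s<g t<g (v<n i i<n) (v<n _ (mod-< (suc i)))) (all-upTo n))

standing⇒nonZero : ∀ {n a₁ a₂} → Standing n a₁ a₂ → NonZero n
standing⇒nonZero {a₁ = a₁} st =
  >-nonZero (≤-trans (≤-trans (Standing.a₁-pos st) (m≤m*n a₁ 2)) (Standing.a₁-le st))

proposition10 : (n a₁ a₂ : ℕ) → Standing n a₁ a₂ →
    (v : ℕ → ℕ) → IsHamCycle n a₁ a₂ v →
    IsHamCycle n a₁ a₂ (λ i → (v i + a₂) mod n) ×
    (∀ s → s < g₁ n a₁ →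
      countA₂ n a₁ a₂ v s ((suc s) mod g₁ n a₁)
        ≡ countA₂ n a₁ a₂ (λ i → (v i + a₂) mod n)
                  ((suc s) mod g₁ n a₁) ((suc (suc s)) mod g₁ n a₁))
proposition10 n a₁ a₂ st v H@(v<n , _) = isHamCycle-τ H , λ s s<g → begin
    countA₂ n a₁ a₂ v s (suc s mod g)
  ≡⟨ countA₂-τ v<n s<g (G.mod-< (suc s)) ⟩
    countA₂ n a₁ a₂ (τ ∘ v) (suc s mod g) (suc (suc s mod g) mod g)
  ≡⟨ cong (countA₂ n a₁ a₂ (τ ∘ v) (suc s mod g)) (G.suc-mod-mod (suc s)) ⟩
    countA₂ n a₁ a₂ (τ ∘ v) (suc s mod g) (suc (suc s) mod g)
  ∎
  where
  instance
    n-nonZero : NonZero n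
    n-nonZero = standing⇒nonZero st
  open Translation n a₂
  open Columns n a₁ a₂ (Standing.g₁>1 st)
  module G = Congruence g
  open ≡.≡-Reasoning
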